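{- In a slim or smooth heap, if a delete-min does $k$ links, at least $k/3-2/3$ of them are good.
   Context: In slim and smooth heaps, a delete-min deletes the root of the heap-ordered tree, makes its children a list of roots, and does leftmost locally maximum linking: find the leftmost three consecutive roots $u,v,w$ with $v.\mathit{key}\ge\max\{u.\mathit{key},w.\mathit{key}\}$ and link $v$ with whichever of $u,w$ has larger key (with $u$ on ties), treating the list as having dummy roots of key $-\infty$ at both ends; linking makes the root of smaller key (the winner) the parent of the other (the loser); repeat until one root remains. Consider any sequence of heap operations. A node is temporary if it is eventually deleted by some delete-min in the sequence, and permanent otherwise. A link done during a delete-min is good if its loser is temporary or its winner is permanent, and bad otherwise. -}

module Defs where

open import Data.Nat using (ℕ; zero; suc; _≤ᵇ_)
open import Data.Bool using (Bool; true; false; _∨_; _∧_; if_then_else_)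
open import Data.List using (List; []; _∷_; length)
open import Data.Maybe using (Maybe; just; nothing)
open import Data.Product using (_×_; _,_)

data Status : Set where
  temporary permanent : Status

record Node : Set where
  constructor node
  field
    key    : ℕ
    status : Status
open Node public

isTemporary : Node → Bool
isTemporary n with status n
... | temporary = true
... | permanent = false

isPermanent : Node → Bool
isPermanent n with status n
... | temporary = false
... | permanent = true

record Link : Set where
  constructor mkLink
  field
    winner : Node
    loser  : Node
open Link public

isGood : Link → Bool
isGood l = isTemporary (loser l) ∨ isPermanent (winner l)

-- Leftmost locally maximum linking.  Dummy roots of key -∞ at both ends
-- are represented by 'nothing'.

≤key : Maybe Node → Node → Bool
≤key nothing  v = true
≤key (just u) v = key u ≤ᵇ key v

partner : Node → Node → Maybe Node
partner u w = if key w ≤ᵇ key u then just u else just w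

choose : Maybe Node → Maybe Node → Maybe Node
choose nothing  nothing  = nothing
choose nothing  (just w) = just w
choose (just u) nothing  = just u
choose (just u) (just w) = partner u w

-- One linking step.  'findLink u rs': u is the root immediately left of
-- the list rs (nothing = left dummy).  Since v.key ≥ x.key, x is the winner
-- (on equal keys v, the locally maximum root, is the loser).  The winner
-- stays a root with the same key, so the new root list is rs with v
-- removed.  Returns nothing iff at most one root remains.
headM : List Node → Maybe Node
headM []      = nothing
headM (x ∷ _) = just x

findLink : Maybe Node → List Node → Maybe (List Node × Link)
findLink u []       = nothing
findLink u (v ∷ rs) with ≤key u v ∧ ≤key (headM rs) v
... | true with choose u (headM rs)
...   | nothing = nothing
...   | just x  = just (rs , mkLink x v)
findLink u (v ∷ rs) | false with findLink (just v) rs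
... | nothing         = nothing
... | just (rs′ , l)  = just (v ∷ rs′ , l)

-- Repeat until one root remains (fuel: each step removes one root, so
-- 'length rs' steps always suffice).
linksFuel : ℕ → List Node → List Link
linksFuel zero    rs = []
linksFuel (suc n) rs with findLink nothing rs
... | nothing        = []
... | just (rs′ , l) = l ∷ linksFuel n rs′

-- The links done by a delete-min whose deleted root has the children
-- rs (left to right) as the new list of roots.
deleteMinLinks : List Node → List Link
deleteMinLinks rs = linksFuel (length rs) rs

countGood : List Link → ℕ
countGood []       = 0
countGood (l ∷ ls) = if isGood l then suc (countGood ls) else countGood ls

{-# OPTIONS --safe #-}
module Submission where

-- Give every root a debt, initially 0.  A bad link (temporary winner,
-- permanent loser) is booked by raising the winner's debt by 1; a good link
-- is worth 3, which pays for itself and for the debt, at most 2, that its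
-- loser takes out of the root list.  So at every moment the links done so
-- far number at most 3 times the good ones plus the total debt, and it
-- remains to see that the debt is at most 2 at the end.  That follows from
-- an invariant of leftmost locally maximum linking: the roots before the
-- leftmost local maximum have strictly increasing keys and debt at most 1,
-- permanent roots never have debt, and debt 2 can only sit on a temporary
-- leftmost local maximum, with no debt to its right.  Indeed only a
-- neighbour of the leftmost local maximum v gains debt: the right one had
-- none, and the left one, when it wins, has at least the key of the root
-- after v and so becomes the leftmost local maximum itself.

open import Defs
open import Data.Nat using (ℕ; _+_; _*_; _≤_)
open import Data.List using (List; length)

open import Data.Nat using (zero; suc; _<_; _≤ᵇ_; z≤n; s≤s)
open import Data.Nat.Properties
open import Data.Nat.Tactic.RingSolver using (solve-∀)
open import Data.Bool using (true; false; T; if_then_else_)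
open import Data.Bool.Properties using (T-≡)
open import Data.List using ([]; _∷_; map)
open import Data.Nat.ListAction using (sum)
open import Data.List.Properties using (map-∘; map-id; length-map)
open import Data.List.Relation.Unary.All using (All; []; _∷_; universal)
open import Data.List.Relation.Unary.All.Properties using (map⁺)
open import Data.Maybe using (Maybe; just; nothing)
open import Data.Product using (_×_; _,_; proj₁; proj₂)
open import Data.Unit using (⊤; tt)
open import Data.Empty using (⊥; ⊥-elim)
open import Function using (_$_)
open import Function.Bundles using (module Equivalence)
open import Relation.Binary.PropositionalEquality

≤ᵇ-true : ∀ {m n} → m ≤ n → (m ≤ᵇ n) ≡ true
≤ᵇ-true m≤n = Equivalence.to T-≡ (≤⇒≤ᵇ m≤n)

≤ᵇ-true⁻¹ : ∀ {m n} → (m ≤ᵇ n) ≡ true → m ≤ n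
≤ᵇ-true⁻¹ {m} {n} eq = ≤ᵇ⇒≤ m n (Equivalence.from T-≡ eq)

≤ᵇ-false⁻¹ : ∀ {m n} → (m ≤ᵇ n) ≡ false → n < m
≤ᵇ-false⁻¹ eq = ≰⇒> (λ m≤n → subst T eq (≤⇒≤ᵇ m≤n))

Entry : Set
Entry = Node × ℕ

nodes : List Entry → List Node
nodes = map proj₁

totalDebt : List Entry → ℕ
totalDebt xs = sum (map proj₂ xs)

Debtless : Entry → Set
Debtless (_ , d) = d ≡ 0

PermanentDebtless : Node → ℕ → Set
PermanentDebtless x d = status x ≡ permanent → d ≡ 0

Below : Maybe Node → Node → Set
Below nothing  _ = ⊤
Below (just u) v = key u < key v

data DebtInvariant : Maybe Node → List Entry → Set where
  debtless  : ∀ {u xs} → All Debtless xs → DebtInvariant u xs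
  ascending : ∀ {u x d xs} → Below u x → d ≤ 1 → PermanentDebtless x d →
              DebtInvariant (just x) xs → DebtInvariant u ((x , d) ∷ xs)
  peak      : ∀ {u x xs} → Below u x → status x ≡ temporary →
              ≤key (headM (nodes xs)) x ≡ true → All Debtless xs →
              DebtInvariant u ((x , 2) ∷ xs)

invariant-tail : ∀ {u v dv xs} → DebtInvariant u ((v , dv) ∷ xs) → DebtInvariant (just v) xs
invariant-tail (debtless (_ ∷ zs))   = debtless zs
invariant-tail (ascending _ _ _ inv) = inv
invariant-tail (peak _ _ _ zs)       = debtless zs

debt-bounds : ∀ {u v dv xs} → DebtInvariant u ((v , dv) ∷ xs) → dv ≤ 2 × PermanentDebtless v dv
debt-bounds (debtless (refl ∷ _))   = z≤n , λ _ → refl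
debt-bounds (ascending _ d≤1 pd _) = m≤n⇒m≤1+n d≤1 , pd
debt-bounds (peak _ refl _ _)      = ≤-refl , λ ()

local-maximum-tail-debtless : ∀ {v xs} → DebtInvariant (just v) xs →
  ≤key (headM (nodes xs)) v ≡ true → All Debtless xs
local-maximum-tail-debtless (debtless zs)          _  = zs
local-maximum-tail-debtless (ascending v<x _ _ _) x≤v = ⊥-elim (<⇒≱ v<x (≤ᵇ-true⁻¹ x≤v))
local-maximum-tail-debtless (peak v<x _ _ _)      x≤v = ⊥-elim (<⇒≱ v<x (≤ᵇ-true⁻¹ x≤v))

ascending-head : ∀ {u x dx v dv xs} → DebtInvariant u ((x , dx) ∷ (v , dv) ∷ xs) → key x < key v →
  dx ≤ 1 × PermanentDebtless x dx × DebtInvariant (just x) ((v , dv) ∷ xs)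
ascending-head (debtless (refl ∷ zs))  _   = z≤n , (λ _ → refl) , debtless zs
ascending-head (ascending _ d≤1 pd inv) _   = d≤1 , pd , inv
ascending-head (peak _ _ v≤x _)         x<v = ⊥-elim (<⇒≱ x<v (≤ᵇ-true⁻¹ v≤x))

credit : Link → ℕ
credit l = if isGood l then 3 else 0

credit-countGood : ∀ l ls → credit l + 3 * countGood ls ≡ 3 * countGood (l ∷ ls)
credit-countGood l ls with isGood l
... | true  = sym (*-suc 3 (countGood ls))
... | false = refl

record Pays (l : Link) (before after : ℕ) : Set where
  constructor paying
  field
    bound : suc before ≤ after + credit l

pays-+ˡ : ∀ {l x y} a → Pays l x y → Pays l (a + x) (a + y)
pays-+ˡ {l} {x} {y} a (paying p) = paying $ begin
  suc (a + x)        ≡⟨ sym (+-suc a x) ⟩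
  a + suc x          ≤⟨ +-monoʳ-≤ a p ⟩
  a + (y + credit l) ≡⟨ sym (+-assoc a y (credit l)) ⟩
  a + y + credit l   ∎
  where open ≤-Reasoning

pays-loser∷winner : ∀ {l d} dv dx c → Pays l (dv + dx) d → Pays l (dv + (dx + c)) (d + c)
pays-loser∷winner {l} {d} dv dx c (paying p) = paying $ begin
  suc (dv + (dx + c)) ≡⟨ cong suc (sym (+-assoc dv dx c)) ⟩
  suc (dv + dx) + c   ≤⟨ +-monoˡ-≤ c p ⟩
  d + credit l + c    ≡⟨ swap d (credit l) c ⟩
  d + c + credit l    ∎
  where
  open ≤-Reasoning
  swap : ∀ a b c → a + b + c ≡ a + c + b
  swap = solve-∀

pays-winner∷loser : ∀ {l d} dv dx c → Pays l (dv + dx) d → Pays l (dx + (dv + c)) (d + c)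
pays-winner∷loser {l} {d} dv dx c p =
  subst (λ s → Pays l s (d + c)) (swap dv dx c) (pays-loser∷winner dv dx c p)
  where
  swap : ∀ a b c → a + (b + c) ≡ b + (a + c)
  swap = solve-∀

data Raised (x : Node) (d : ℕ) : ℕ → Set where
  unchanged : Raised x d d
  raised    : status x ≡ temporary → Raised x d (suc d)

raised-from-0 : ∀ {x d} → Raised x 0 d → d ≤ 1
raised-from-0 unchanged  = z≤n
raised-from-0 (raised _) = s≤s z≤n

good-link-pays : ∀ {dv dx} → dv ≤ 2 → suc (dv + dx) ≤ dx + 3
good-link-pays {_} {dx} dv≤2 = ≤-trans (s≤s (+-monoˡ-≤ dx dv≤2)) (≤-reflexive (+-comm 3 dx))

record WinnerDebt (x v : Node) (dx dv : ℕ) : Set where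
  constructor winnerDebt
  field
    debt               : ℕ
    permanent-debtless : PermanentDebtless x debt
    raised-debt        : Raised x dx debt
    pays               : Pays (mkLink x v) (dv + dx) debt

winner-debt : ∀ x v {dx dv} → dv ≤ 2 → PermanentDebtless v dv → PermanentDebtless x dx →
  WinnerDebt x v dx dv
winner-debt x (node _ temporary) dv≤2 _ pdx =
  winnerDebt _ pdx unchanged (paying (good-link-pays dv≤2))
winner-debt (node _ permanent) (node _ permanent) dv≤2 _ pdx =
  winnerDebt _ pdx unchanged (paying (good-link-pays dv≤2))
winner-debt (node _ temporary) (node _ permanent) _ pdv _ with pdv refl
... | refl = winnerDebt _ (λ ()) (raised refl) (paying (≤-reflexive (sym (+-identityʳ _))))

left-winner-invariant : ∀ {u x dx dx′ xs} → Below u x → dx ≤ 1 → PermanentDebtless x dx′ →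
  Raised x dx dx′ → ≤key (headM (nodes xs)) x ≡ true → All Debtless xs →
  DebtInvariant u ((x , dx′) ∷ xs)
left-winner-invariant u<x dx≤1 pd unchanged _ zs = ascending u<x dx≤1 pd (debtless zs)
left-winner-invariant {dx = zero} u<x _ pd (raised _) _ zs = ascending u<x (s≤s z≤n) pd (debtless zs)
left-winner-invariant {dx = suc zero} u<x _ _ (raised tmp) xs≤x zs = peak u<x tmp xs≤x zs
left-winner-invariant {dx = suc (suc _)} _ (s≤s ()) _ (raised _) _ _

record LinkStep (u : Maybe Node) (xs : List Entry) (rs : List Node) (l : Link) : Set where
  constructor linkStep
  field
    entries       : List Entry
    nodes-entries : nodes entries ≡ rs
    invariant     : DebtInvariant u entries
    one-shorter   : suc (length entries) ≡ length xs
    paid          : Pays l (totalDebt xs) (totalDebt entries)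

Outcome : Set → (List Node → Link → Set) → Maybe (List Node × Link) → Set
Outcome Done Step nothing         = Done
Outcome Done Step (just (rs , l)) = Step rs l

findLink-ascending : ∀ {t} u du v dv xs → DebtInvariant t ((u , du) ∷ (v , dv) ∷ xs) →
  Below t u → key u < key v →
  Outcome ⊥ (λ rs → LinkStep t ((u , du) ∷ (v , dv) ∷ xs) (u ∷ rs))
            (findLink (just u) (v ∷ nodes xs))
findLink-ascending u du v dv [] inv t<u u<v
  rewrite ≤ᵇ-true (<⇒≤ u<v) =
  let du≤1 , pdu , inv′       = ascending-head inv u<v
      dv≤2 , pdv              = debt-bounds inv′
      winnerDebt du′ pdu′ r p = winner-debt u v dv≤2 pdv pdu
  in linkStep ((u , du′) ∷ []) refl (left-winner-invariant t<u du≤1 pdu′ r refl [])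
       refl (pays-winner∷loser dv du 0 p)
findLink-ascending u du v dv ((w , dw) ∷ xs) inv t<u u<v
  rewrite ≤ᵇ-true (<⇒≤ u<v)
  with ascending-head inv u<v
... | du≤1 , pdu , inv′
  with debt-bounds inv′ | key w ≤ᵇ key v in w≤v
... | dv≤2 , pdv | true
  with local-maximum-tail-debtless (invariant-tail inv′) w≤v | key w ≤ᵇ key u in w≤u
... | refl ∷ zs | true =
  let winnerDebt du′ pdu′ r p = winner-debt u v dv≤2 pdv pdu
  in linkStep ((u , du′) ∷ (w , 0) ∷ xs) refl
       (left-winner-invariant t<u du≤1 pdu′ r w≤u (refl ∷ zs)) refl (pays-winner∷loser dv du _ p)
... | refl ∷ zs | false =
  let winnerDebt dw′ pdw′ r p = winner-debt w v dv≤2 pdv (λ _ → refl)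
  in linkStep ((u , du) ∷ (w , dw′) ∷ xs) refl
       (ascending t<u du≤1 pdu (ascending (≤ᵇ-false⁻¹ w≤u) (raised-from-0 r) pdw′ (debtless zs)))
       refl (pays-+ˡ du (pays-loser∷winner dv 0 _ p))
findLink-ascending u du v dv ((w , dw) ∷ xs) inv t<u u<v | du≤1 , pdu , inv′ | dv≤2 , pdv | false
  with findLink (just v) (w ∷ nodes xs) | findLink-ascending v dv w dw xs inv′ u<v (≤ᵇ-false⁻¹ w≤v)
... | nothing      | ()
... | just (_ , _) | linkStep ys nodes-ys inv″ shorter p =
  linkStep ((u , du) ∷ ys) (cong (u ∷_) nodes-ys) (ascending t<u du≤1 pdu inv″)
    (cong suc shorter) (pays-+ˡ du p)

findLink-step : ∀ xs → DebtInvariant nothing xs →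
  Outcome (totalDebt xs ≤ 2) (LinkStep nothing xs) (findLink nothing (nodes xs))
findLink-step [] _ = z≤n
findLink-step ((v , dv) ∷ []) inv = subst (_≤ 2) (sym (+-identityʳ dv)) (proj₁ (debt-bounds inv))
findLink-step ((v , dv) ∷ (w , dw) ∷ xs) inv with debt-bounds inv | key w ≤ᵇ key v in w≤v
... | dv≤2 , pdv | true with local-maximum-tail-debtless (invariant-tail inv) w≤v
... | refl ∷ zs =
  let winnerDebt dw′ pdw′ r p = winner-debt w v dv≤2 pdv (λ _ → refl)
  in linkStep ((w , dw′) ∷ xs) refl (ascending tt (raised-from-0 r) pdw′ (debtless zs))
       refl (pays-loser∷winner dv 0 _ p)
findLink-step ((v , dv) ∷ (w , dw) ∷ xs) inv | _ | false
  with findLink (just v) (w ∷ nodes xs) | findLink-ascending v dv w dw xs inv tt (≤ᵇ-false⁻¹ w≤v)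
... | nothing      | ()
... | just (_ , _) | step = step

links-bound-step : ∀ {l ls k x y} → Pays l x y → k + y ≤ 3 * countGood ls + 2 →
  suc k + x ≤ 3 * countGood (l ∷ ls) + 2
links-bound-step {l} {ls} {k} {x} {y} (paying p) bound = begin
  suc k + x                         ≡⟨ sym (+-suc k x) ⟩
  k + suc x                         ≤⟨ +-monoʳ-≤ k p ⟩
  k + (y + credit l)                ≡⟨ sym (+-assoc k y (credit l)) ⟩
  k + y + credit l                  ≤⟨ +-monoˡ-≤ (credit l) bound ⟩
  3 * countGood ls + 2 + credit l   ≡⟨ rotate (3 * countGood ls) 2 (credit l) ⟩
  credit l + 3 * countGood ls + 2   ≡⟨ cong (_+ 2) (credit-countGood l ls) ⟩
  3 * countGood (l ∷ ls) + 2        ∎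
  where
  open ≤-Reasoning
  rotate : ∀ a b c → a + b + c ≡ c + a + b
  rotate = solve-∀

links-bound : ∀ n xs → DebtInvariant nothing xs → length xs ≡ n → ∀ {rs} → nodes xs ≡ rs →
  length (linksFuel n rs) + totalDebt xs ≤ 3 * countGood (linksFuel n rs) + 2
links-bound zero    []  _   _       refl = z≤n
links-bound (suc n) xs  inv |xs|≡n refl with findLink nothing (nodes xs) | findLink-step xs inv
... | nothing      | final-debt = final-debt
... | just (_ , l) | linkStep ys refl inv′ shorter p =
  links-bound-step {ls = linksFuel n (nodes ys)} p
    (links-bound n ys inv′ (suc-injective (trans shorter |xs|≡n)) refl)

lemma4p5 : (roots : List Node) →
    length (deleteMinLinks roots) ≤ 3 * countGood (deleteMinLinks roots) + 2
lemma4p5 roots = ≤-trans (m≤m+n _ _)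
  (links-bound (length roots) fresh (debtless (map⁺ (universal (λ _ → refl) roots)))
     (length-map _ roots) (trans (sym (map-∘ roots)) (map-id roots)))
  where
  fresh : List Entry
  fresh = map (λ r → r , 0) roots
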